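{- Let $\lambda=(\lambda_1,\lambda_2)$ be a partition of $n$ with $\lambda_1\ge\lambda_2\ge 1$, let $m$ be an integer with $\max\{\lambda_1,\lambda_2+1\}\le m\le n$, and let $E$ be an equivalence class of $\mathrm{IGLT}(\lambda)_m$ under the relation $\sim_{\lambda;m}$. Then for any $T_1,T_2\in E$, the standard Young tableaux $\Phi_{\lambda;m}(T_1)$ and $\Phi_{\lambda;m}(T_2)$ have the same shape.
   Context: The Young diagram of $\lambda$ is the set of boxes $(i,j)$ with $i\in\{1,2\}$, $1\le j\le\lambda_i$ (row $i$ from the top, column $j$ from the left). An increasing gapless tableau of shape $\lambda$ is a filling $T$ of the boxes by positive integers with entries strictly increasing left to right along rows and top to bottom along columns, such that every integer $1\le k\le\max(T)$ occurs. $\mathrm{IGLT}(\lambda)_m$ is the set of such tableaux with maximum entry $m$. For such $T$, let $\mathcal I(T)=\{i\in[1,m] : |T^{ -1}(i)|>1\}$. For $i$, let $(r_t^{(i)},c_t^{(i)})$ and $(r_b^{(i)},c_b^{(i)})$ be the topmost and bottommost boxes of $T^{ -1}(i)$. Let $\langle i,j\rangle$ denote the lattice point on the $(i+1)$st horizontal grid line from the top and the $(j+1)$st vertical grid line from the left. For $i\in\mathcal I(T)$, $\Gamma_i(T)$ is the lattice path along grid lines from $\langle r_b^{(i)},c_b^{(i)}-1\rangle$ to $\langle r_t^{(i)}-1,c_t^{(i)}\rangle$ such that (i) whenever it passes horizontally between two vertically adjacent boxes, the upper box has entry $<i$ and the lower box has entry $\ge i$; (ii) whenever it passes vertically between two horizontally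 adjacent boxes, the left box has entry $<i$ and the right box has entry $\ge i$ (boxes outside $\mathbb Z_{>0}^2$ are treated as having entry $-\infty$, and boxes in $\mathbb Z_{>0}^2$ outside the diagram as having entry $\infty$). Define $T_1\sim_{\lambda;m}T_2$ iff $\{(\Gamma_i(T_1),T_1^{ -1}(i)) : i\in\mathcal I(T_1)\}=\{(\Gamma_i(T_2),T_2^{ -1}(i)) : i\in\mathcal I(T_2)\}$. The map $\Phi_{\lambda;m}$ sends $T\in\mathrm{IGLT}(\lambda)_m$ to the tableau $S_T$ obtained as follows: let $A=\mathcal I(T)$ and let $B$ be the set of entries in the second row of $T$ lying immediately to the right of (a box in the second row containing) an element of $A$; delete the elements of $A$ from the first row and the elements of $B$ from the second row; then insert the elements of $B$ into the first column (as new one-box rows below the existing rows), so that the first column remains increasing. The result $S_T$ is a standard Young tableau (it is known that $\Phi_{\lambda;m}$ is a bijection from $\mathrm{IGLT}(\lambda)_m$ onto the union of the sets of standard Young tableaux of the shapes in a certain set of partitions of $m$). -}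

module Defs where

open import Data.Nat using (ℕ; zero; suc; _+_; _∸_; _≤_; _<_; _≡ᵇ_; _<ᵇ_)
open import Data.Bool using (Bool; true; false; if_then_else_; not; _∧_; _∨_)
open import Data.List using (List; []; _∷_; length; map; filterᵇ)
open import Data.Bool.ListAction using (any)
open import Data.Product using (Σ; ∃; _×_; _,_)
open import Data.Unit using (⊤)
open import Data.Empty using (⊥)
open import Function.Bundles using (_⇔_)
open import Relation.Binary.PropositionalEquality using (_≡_)

record Tab : Set where
  constructor tab
  field
    row₁ : List ℕ
    row₂ : List ℕ
open Tab public

-- Extended entries: boxes outside ℤ_{>0}² are -∞, boxes in ℤ_{>0}²
-- outside the diagram are +∞.
data Ext : Set where
  -∞ : Ext
  fin : ℕ → Ext
  +∞ : Ext

lookupExt : List ℕ → ℕ → Ext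
lookupExt []       _       = +∞
lookupExt (x ∷ xs) zero    = fin x
lookupExt (x ∷ xs) (suc k) = lookupExt xs k

-- at T r c : the entry of box (r , c) (row r from the top, column c
-- from the left, both 1-based), extended by ±∞ as in the paper.
at : Tab → ℕ → ℕ → Ext
at T zero c                         = -∞
at T (suc r) zero                   = -∞
at T 1 (suc c)                      = lookupExt (row₁ T) c
at T 2 (suc c)                      = lookupExt (row₂ T) c
at T (suc (suc (suc r))) (suc c)    = +∞

Lt : Ext → ℕ → Set
Lt -∞      i = ⊤
Lt (fin x) i = x < i
Lt +∞      i = ⊥

Ge : Ext → ℕ → Set
Ge -∞      i = ⊥
Ge (fin x) i = i ≤ x
Ge +∞      i = ⊤

record IsIGLT (λ₁ λ₂ m : ℕ) (T : Tab) : Set where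
  field
    len₁     : length (row₁ T) ≡ λ₁
    len₂     : length (row₂ T) ≡ λ₂
    positive : ∀ r c x → at T r c ≡ fin x → 1 ≤ x
    rowInc   : ∀ r c x y → at T r c ≡ fin x → at T r (suc c) ≡ fin y → x < y
    colInc   : ∀ r c x y → at T r c ≡ fin x → at T (suc r) c ≡ fin y → x < y
    bounded  : ∀ r c x → at T r c ≡ fin x → x ≤ m
    gapless  : ∀ k → 1 ≤ k → k ≤ m → ∃ λ r → ∃ λ c → at T r c ≡ fin k

countᵇ : ℕ → List ℕ → ℕ
countᵇ i xs = length (filterᵇ (λ x → x ≡ᵇ i) xs)

mult : Tab → ℕ → ℕ
mult T i = countᵇ i (row₁ T) + countᵇ i (row₂ T)

InI : Tab → ℕ → ℕ → Set
InI T m i = (1 ≤ i) × (i ≤ m) × (1 < mult T i)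

-- Boolean version used to compute Φ (all entries lie in [1,m] anyway)
inIᵇ : Tab → ℕ → Bool
inIᵇ T i = 1 <ᵇ mult T i

IsTop : Tab → ℕ → ℕ → ℕ → Set
IsTop T i r c = (at T r c ≡ fin i) × (∀ r' c' → at T r' c' ≡ fin i → r ≤ r')

IsBottom : Tab → ℕ → ℕ → ℕ → Set
IsBottom T i r c = (at T r c ≡ fin i) × (∀ r' c' → at T r' c' ≡ fin i → r' ≤ r)

-- A point ⟨y , x⟩ lies on the (y+1)st horizontal grid
-- line from the top and the (x+1)st vertical grid line from the left.
-- A lattice path is a sequence of unit steps N (up: y ↦ y-1) and
-- E (right: x ↦ x+1).

data Step : Set where
  N E : Step

Path : Set
Path = List Step

-- Walk T i y x p y' x' : the path p, started at ⟨y,x⟩, stays on the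
-- grid, ends at ⟨y',x'⟩ and satisfies conditions (i) and (ii) for i.
--  * an N step from ⟨y+1,x⟩ to ⟨y,x⟩ runs vertically between the
--    horizontally adjacent boxes (y+1,x) (left) and (y+1,x+1) (right);
--  * an E step from ⟨y,x⟩ to ⟨y,x+1⟩ runs horizontally between the
--    vertically adjacent boxes (y,x+1) (upper) and (y+1,x+1) (lower).
Walk : Tab → ℕ → ℕ → ℕ → Path → ℕ → ℕ → Set
Walk T i y x []      y' x' = (y ≡ y') × (x ≡ x')
Walk T i zero x (N ∷ p) y' x' = ⊥
Walk T i (suc y) x (N ∷ p) y' x' =
  Lt (at T (suc y) x) i × Ge (at T (suc y) (suc x)) i × Walk T i y x p y' x'
Walk T i y x (E ∷ p) y' x' =
  Lt (at T y (suc x)) i × Ge (at T (suc y) (suc x)) i × Walk T i y (suc x) p y' x'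

IsΓ : Tab → ℕ → Path → Set
IsΓ T i p = ∃ λ rt → ∃ λ ct → ∃ λ rb → ∃ λ cb →
  IsTop T i rt ct × IsBottom T i rb cb × Walk T i rb (cb ∸ 1) p (rt ∸ 1) ct

-- The relation ∼_{λ;m}: equality of the sets
--   { (Γ_i(T), T⁻¹(i)) : i ∈ 𝓘(T) }.

SamePair : Tab → ℕ → Tab → ℕ → Set
SamePair T₁ i T₂ j =
  (∀ p → IsΓ T₁ i p ⇔ IsΓ T₂ j p) ×
  (∀ r c → (at T₁ r c ≡ fin i) ⇔ (at T₂ r c ≡ fin j))

Sim : ℕ → Tab → Tab → Set
Sim m T₁ T₂ =
  (∀ i → InI T₁ m i → ∃ λ j → InI T₂ m j × SamePair T₁ i T₂ j) ×
  (∀ j → InI T₂ m j → ∃ λ i → InI T₁ m i × SamePair T₁ i T₂ j)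

rightOf : (ℕ → Bool) → List ℕ → List ℕ
rightOf p (x ∷ y ∷ ys) = if p x then y ∷ rightOf p (y ∷ ys) else rightOf p (y ∷ ys)
rightOf p _            = []

memᵇ : ℕ → List ℕ → Bool
memᵇ x xs = any (λ y → y ≡ᵇ x) xs

-- S_T as a list of rows (top to bottom).  B is already increasing, so
-- appending its elements as one-box rows keeps the first column increasing.
Φ : Tab → List (List ℕ)
Φ T = filterᵇ (λ x → not (inIᵇ T x)) (row₁ T)
    ∷ filterᵇ (λ x → not (memᵇ x B)) (row₂ T)
    ∷ map (λ b → b ∷ []) B
  where
  B : List ℕ
  B = rightOf (inIᵇ T) (row₂ T)

shape : List (List ℕ) → List ℕ
shape rows = map length rows

-- The shape of Φ(T) is read off from the positions of the boxes of T
-- holding a repeated entry, i.e. an element of 𝓘(T): row 1 loses those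
-- boxes, and row 2 loses the boxes immediately to the right of them,
-- which reappear as one-box rows.  (Since row 2 is strictly increasing,
-- an entry of row 2 lies in B exactly when its left neighbour is
-- repeated.)  If T₁ ∼ T₂, each repeated entry of T₁ occupies the same
-- set of boxes as some repeated entry of T₂ and vice versa, so these
-- positions, and hence the shapes, agree.
module Submission where

open import Defs
open import Data.Nat using (ℕ; _+_; _≤_; _⊔_)
open import Relation.Binary.PropositionalEquality using (_≡_)

open import Data.Nat using (suc; _<_)
open import Data.Nat.Properties using (<ᵇ⇒<; <⇒<ᵇ; <-trans; <⇒≢; _≟_; suc-injective)
open import Data.Bool using (Bool; true; false; not; T; _∨_; if_then_else_)
open import Data.Empty using (⊥-elim)
open import Data.List using (List; []; _∷_; length; map; filterᵇ; replicate)
open import Data.List.Properties using (∷-injective; ∷-injectiveˡ; ∷-injectiveʳ; map-cong-local)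
open import Data.List.Relation.Unary.All as All using (All; []; _∷_)
open import Data.List.Relation.Unary.Linked using (Linked; []; [-]; _∷_)
open import Data.List.Relation.Unary.Linked.Properties using (Linked⇒All)
open import Data.Product using (_,_)
open import Function using (_∘_)
open import Function.Bundles using (Equivalence)
import Function.Properties.Equivalence as ⇔
open import Relation.Nullary.Decidable using (dec-true; dec-false)
open import Relation.Binary.PropositionalEquality using (refl; sym; trans; cong; cong₂; _≢_; ≢-sym; module ≡-Reasoning)

private
  variable
    A B : Set
    x : ℕ
    xs : List ℕ

T-ext : ∀ {a b} → (T a → T b) → (T b → T a) → a ≡ b
T-ext {false} {false} _   _   = refl
T-ext {false} {true}  _   b⇒a = ⊥-elim (b⇒a _)
T-ext {true}  {false} a⇒b _   = ⊥-elim (a⇒b _)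
T-ext {true}  {true}  _   _   = refl

length-filterᵇ-cong : (f : Bool → Bool) {p : A → Bool} {q : B → Bool} (xs : List A) (ys : List B) →
  map p xs ≡ map q ys → length (filterᵇ (f ∘ p) xs) ≡ length (filterᵇ (f ∘ q) ys)
length-filterᵇ-cong f []       []       _  = refl
length-filterᵇ-cong f {p} {q} (x ∷ xs) (y ∷ ys) eq with ∷-injective eq
... | px≡qy , rest with f (p x) | f (q y) | cong f px≡qy
...   | true  | .true  | refl = cong suc (length-filterᵇ-cong f xs ys rest)
...   | false | .false | refl = length-filterᵇ-cong f xs ys rest

length-rightOf-cong : {p q : ℕ → Bool} (xs ys : List ℕ) →
  map p xs ≡ map q ys → length (rightOf p xs) ≡ length (rightOf q ys)
length-rightOf-cong []       []       _ = refl
length-rightOf-cong (_ ∷ []) (_ ∷ []) _ = refl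
length-rightOf-cong (_ ∷ xs@(_ ∷ _)) (_ ∷ ys@(_ ∷ _)) eq =
  length-if-∷ (∷-injectiveˡ eq) (length-rightOf-cong xs ys (∷-injectiveʳ eq))
  where
  length-if-∷ : ∀ {a b} {u v : List ℕ} {z w : ℕ} → a ≡ b → length u ≡ length v →
    length (if a then z ∷ u else u) ≡ length (if b then w ∷ v else v)
  length-if-∷ {true}  refl e = cong suc e
  length-if-∷ {false} refl e = e

map-length-singletons : (xs : List A) → map length (map (λ b → b ∷ []) xs) ≡ replicate (length xs) 1
map-length-singletons []       = refl
map-length-singletons (x ∷ xs) = cong (1 ∷_) (map-length-singletons xs)

All-rightOf : ∀ {P : ℕ → Set} (p : ℕ → Bool) x → All P xs → All P (rightOf p (x ∷ xs))
All-rightOf p x []               = []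
All-rightOf p x (Py ∷ Pys) with p x
... | true  = Py ∷ All-rightOf p _ Pys
... | false = All-rightOf p _ Pys

memᵇ-self : ∀ x R → memᵇ x (x ∷ R) ≡ true
memᵇ-self x R = cong (λ b → b ∨ memᵇ x R) (dec-true (x ≟ x) refl)

memᵇ-skip : ∀ {y} R → y ≢ x → memᵇ x (y ∷ R) ≡ memᵇ x R
memᵇ-skip {x} R y≢x = cong (λ b → b ∨ memᵇ x R) (dec-false (_ ≟ _) y≢x)

memᵇ-above : ∀ R → All (x <_) R → memᵇ x R ≡ false
memᵇ-above []      []          = refl
memᵇ-above (y ∷ R) (x<y ∷ x<R) = trans (memᵇ-skip R (≢-sym (<⇒≢ x<y))) (memᵇ-above R x<R)

Linked-head< : Linked _<_ (x ∷ xs) → All (x <_) xs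
Linked-head< [-]          = []
Linked-head< (x<y ∷ rest) = Linked⇒All <-trans x<y rest

delay : Bool → List Bool → List Bool
delay b []       = []
delay b (c ∷ cs) = b ∷ delay c cs

map-memᵇ-rightOf : (p : ℕ → Bool) {xs : List ℕ} → Linked _<_ xs →
  map (λ z → memᵇ z (rightOf p xs)) xs ≡ delay false (map p xs)
map-memᵇ-rightOf p []              = refl
map-memᵇ-rightOf p {x ∷ xs} sorted = from false x xs sorted
  where
  memᵇ-cons? : ∀ b x R → All (x <_) R → memᵇ x (if b then x ∷ R else R) ≡ b
  memᵇ-cons? true  x R _   = memᵇ-self x R
  memᵇ-cons? false x R x<R = memᵇ-above R x<R

  map-memᵇ-cons? : ∀ b x R ys → All (x <_) ys →
    map (λ z → memᵇ z (if b then x ∷ R else R)) ys ≡ map (λ z → memᵇ z R) ys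
  map-memᵇ-cons? true  x R ys x<ys = map-cong-local (All.map (λ x<z → memᵇ-skip R (<⇒≢ x<z)) x<ys)
  map-memᵇ-cons? false x R ys _    = refl

  -- From x onwards, B is rightOf p (x ∷ xs), preceded by x exactly when
  -- the left neighbour of x is marked (b).
  from : ∀ b x xs → Linked _<_ (x ∷ xs) →
    map (λ z → memᵇ z (if b then x ∷ rightOf p (x ∷ xs) else rightOf p (x ∷ xs))) (x ∷ xs)
      ≡ delay b (map p (x ∷ xs))
  from b x xs sorted = cong₂ _∷_
    (memᵇ-cons? b x _ (All-rightOf p x (Linked-head< sorted)))
    (trans (map-memᵇ-cons? b x _ xs (Linked-head< sorted)) (rest xs sorted))
    where
    rest : ∀ xs → Linked _<_ (x ∷ xs) →
      map (λ z → memᵇ z (rightOf p (x ∷ xs))) xs ≡ delay (p x) (map p xs)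
    rest []       _            = refl
    rest (y ∷ ys) (_ ∷ sorted) = from (p x) y ys sorted

shape-Φ-cong : ∀ {T₁ T₂} → Linked _<_ (row₂ T₁) → Linked _<_ (row₂ T₂) →
  map (inIᵇ T₁) (row₁ T₁) ≡ map (inIᵇ T₂) (row₁ T₂) →
  map (inIᵇ T₁) (row₂ T₁) ≡ map (inIᵇ T₂) (row₂ T₂) →
  shape (Φ T₁) ≡ shape (Φ T₂)
shape-Φ-cong {T₁} {T₂} sorted₁ sorted₂ pattern₁ pattern₂ =
  cong₂ _∷_ (length-filterᵇ-cong not (row₁ T₁) (row₁ T₂) pattern₁)
 (cong₂ _∷_ (length-filterᵇ-cong not (row₂ T₁) (row₂ T₂) B-pattern)
            one-box-rows)
  where
  B₁ = rightOf (inIᵇ T₁) (row₂ T₁)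
  B₂ = rightOf (inIᵇ T₂) (row₂ T₂)
  open ≡-Reasoning

  B-pattern : map (λ z → memᵇ z B₁) (row₂ T₁) ≡ map (λ z → memᵇ z B₂) (row₂ T₂)
  B-pattern = begin
    map (λ z → memᵇ z B₁) (row₂ T₁) ≡⟨ map-memᵇ-rightOf (inIᵇ T₁) sorted₁ ⟩
    delay false (map (inIᵇ T₁) (row₂ T₁)) ≡⟨ cong (delay false) pattern₂ ⟩
    delay false (map (inIᵇ T₂) (row₂ T₂)) ≡⟨ map-memᵇ-rightOf (inIᵇ T₂) sorted₂ ⟨
    map (λ z → memᵇ z B₂) (row₂ T₂) ∎

  one-box-rows : map length (map (λ b → b ∷ []) B₁) ≡ map length (map (λ b → b ∷ []) B₂)
  one-box-rows = begin
    map length (map (λ b → b ∷ []) B₁) ≡⟨ map-length-singletons B₁ ⟩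
    replicate (length B₁) 1            ≡⟨ cong (λ n → replicate n 1) (length-rightOf-cong _ _ pattern₂) ⟩
    replicate (length B₂) 1            ≡⟨ map-length-singletons B₂ ⟨
    map length (map (λ b → b ∷ []) B₂) ∎

lookupExt-Linked : ∀ xs → (∀ k {a b} → lookupExt xs k ≡ fin a → lookupExt xs (suc k) ≡ fin b → a < b) →
  Linked _<_ xs
lookupExt-Linked []           _   = []
lookupExt-Linked (_ ∷ [])     _   = [-]
lookupExt-Linked (_ ∷ _ ∷ xs) inc = inc 0 refl refl ∷ lookupExt-Linked (_ ∷ xs) (inc ∘ suc)

map-cong-lookupExt : ∀ {f g : ℕ → A} xs ys →
  (∀ k {a b} → lookupExt xs k ≡ fin a → lookupExt ys k ≡ fin b → f a ≡ g b) →
  length xs ≡ length ys → map f xs ≡ map g ys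
map-cong-lookupExt []       []       _  _   = refl
map-cong-lookupExt (x ∷ xs) (y ∷ ys) eq len =
  cong₂ _∷_ (eq 0 refl refl) (map-cong-lookupExt xs ys (eq ∘ suc) (suc-injective len))

row₂-sorted : ∀ {λ₁ λ₂ m T} → IsIGLT λ₁ λ₂ m T → Linked _<_ (row₂ T)
row₂-sorted I = lookupExt-Linked _ (λ k → IsIGLT.rowInc I 2 (suc k) _ _)

SamePair-sym : ∀ {T₁ i T₂ j} → SamePair T₁ i T₂ j → SamePair T₂ j T₁ i
SamePair-sym (paths , boxes) = (λ p → ⇔.sym (paths p)) , (λ r c → ⇔.sym (boxes r c))

Sim-sym : ∀ {m T₁ T₂} → Sim m T₁ T₂ → Sim m T₂ T₁
Sim-sym (to , from) =
  (λ j Ij → let i , Ii , same = from j Ij in i , Ii , SamePair-sym same) ,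
  (λ i Ii → let j , Ij , same = to i Ii in j , Ij , SamePair-sym same)

Sim-repeated : ∀ {λ₁ λ₂ m T₁ T₂} → IsIGLT λ₁ λ₂ m T₁ → Sim m T₁ T₂ → ∀ r c {x y} →
  at T₁ r c ≡ fin x → at T₂ r c ≡ fin y → T (inIᵇ T₁ x) → T (inIᵇ T₂ y)
Sim-repeated I (to , _) r c {x} T₁rc≡x T₂rc≡y repeated
  with to x (IsIGLT.positive I r c x T₁rc≡x , IsIGLT.bounded I r c x T₁rc≡x , <ᵇ⇒< 1 _ repeated)
... | j , (_ , _ , 1<mult) , _ , boxes
  with trans (sym (Equivalence.to (boxes r c) T₁rc≡x)) T₂rc≡y
... | refl = <⇒<ᵇ 1<mult

module _ {λ₁ λ₂ m T₁ T₂} (I₁ : IsIGLT λ₁ λ₂ m T₁) (I₂ : IsIGLT λ₁ λ₂ m T₂) (S : Sim m T₁ T₂) where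

  inIᵇ-at-cong : ∀ r c {x y} → at T₁ r c ≡ fin x → at T₂ r c ≡ fin y → inIᵇ T₁ x ≡ inIᵇ T₂ y
  inIᵇ-at-cong r c T₁rc≡x T₂rc≡y =
    T-ext (Sim-repeated I₁ S r c T₁rc≡x T₂rc≡y) (Sim-repeated I₂ (Sim-sym S) r c T₂rc≡y T₁rc≡x)

  row₁-pattern : map (inIᵇ T₁) (row₁ T₁) ≡ map (inIᵇ T₂) (row₁ T₂)
  row₁-pattern = map-cong-lookupExt _ _ (λ k → inIᵇ-at-cong 1 (suc k))
    (trans (IsIGLT.len₁ I₁) (sym (IsIGLT.len₁ I₂)))

  row₂-pattern : map (inIᵇ T₁) (row₂ T₁) ≡ map (inIᵇ T₂) (row₂ T₂)
  row₂-pattern = map-cong-lookupExt _ _ (λ k → inIᵇ-at-cong 2 (suc k))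
    (trans (IsIGLT.len₂ I₁) (sym (IsIGLT.len₂ I₂)))

lemma3p4 : (λ₁ λ₂ n m : ℕ) → λ₂ ≤ λ₁ → 1 ≤ λ₂ → n ≡ λ₁ + λ₂ →
    λ₁ ⊔ (λ₂ + 1) ≤ m → m ≤ n →
    (T₁ T₂ : Tab) → IsIGLT λ₁ λ₂ m T₁ → IsIGLT λ₁ λ₂ m T₂ →
    Sim m T₁ T₂ →
    shape (Φ T₁) ≡ shape (Φ T₂)
lemma3p4 _ _ _ _ _ _ _ _ _ T₁ T₂ I₁ I₂ S =
  shape-Φ-cong (row₂-sorted I₁) (row₂-sorted I₂) (row₁-pattern I₁ I₂ S) (row₂-pattern I₁ I₂ S)
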